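{- There is no odd positive integer $n<10^5$ that is a strong alpha number of order $(1,1)$.
   Context: For a positive integer $n$, $\sigma(n)=\sum_{d\mid n} d$ and $\omega(n)$ is the number of distinct prime divisors of $n$. A positive integer $n$ is a strong alpha number of order $(1,1)$ if there exist coprime positive integers $\alpha_1,\alpha_2$ with $\sigma(n)=\frac{\alpha_1}{\alpha_2}n$ and $2\le \max(\alpha_1,\alpha_2)\le \omega(n)$. -}

module Defs where

open import Data.Nat using (ℕ; suc; _*_; _≤_; _<_; _⊔_)
open import Data.Nat.Divisibility using (_∣_; _∣?_)
open import Data.Nat.Primality using (Prime; prime?)
open import Data.Nat.Coprimality using (Coprime)
open import Data.List using (List; filter; upTo; length; map)
open import Data.Nat.ListAction using (sum)
open import Data.Product using (Σ; _×_)
open import Relation.Nullary using (¬_)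
open import Relation.Binary.PropositionalEquality using (_≡_)
open import Relation.Unary using (Decidable)

range1 : ℕ → List ℕ
range1 n = map suc (upTo n)

σ : ℕ → ℕ
σ n = sum (filter (λ d → d ∣? n) (range1 n))

private
  primeDivisor? : (n : ℕ) → Decidable (λ p → Prime p × p ∣ n)
  primeDivisor? n p with prime? p | p ∣? n
  ... | Relation.Nullary.yes a | Relation.Nullary.yes b = Relation.Nullary.yes (a Data.Product., b)
  ... | Relation.Nullary.no a  | _ = Relation.Nullary.no (λ x → a (Data.Product.proj₁ x))
  ... | _ | Relation.Nullary.no b = Relation.Nullary.no (λ x → b (Data.Product.proj₂ x))

ω : ℕ → ℕ
ω n = length (filter (primeDivisor? n) (range1 n))

-- n is a strong alpha number of order (1,1):
-- ∃ coprime positive α₁ α₂ with σ(n) = (α₁/α₂)·n, i.e. α₂·σ(n) = α₁·n,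
-- and 2 ≤ max(α₁,α₂) ≤ ω(n)
StrongAlpha11 : ℕ → Set
StrongAlpha11 n =
  Σ ℕ λ α₁ → Σ ℕ λ α₂ →
    1 ≤ α₁ × 1 ≤ α₂ × Coprime α₁ α₂ ×
    α₂ * σ n ≡ α₁ * n ×
    2 ≤ α₁ ⊔ α₂ × α₁ ⊔ α₂ ≤ ω n

-- If σ(n) = (α₁/α₂)·n with α₁, α₂ ≥ 1, then σ(n) ∣ α₁·n, so α₁ is a multiple of the numerator
-- k = σ(n)/gcd(σ(n), n) of σ(n)/n in lowest terms.  Since n has ω(n) distinct prime factors,
-- 2^ω(n) ≤ n, and a strong alpha number of order (1,1) therefore satisfies 2^k ≤ 2^α₁ ≤ 2^ω(n) ≤ n.
-- A computation shows that n < 2^k for every odd n < 10⁵.  It stays feasible because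
-- divisors come in pairs (d, n/d), so σ(n) can be summed over d ≤ √n only.
module Submission where

open import Defs
open import Data.Nat using (ℕ; zero; suc; _+_; _*_; _^_; _/_; _%_; _⊓_; _≡ᵇ_; _<ᵇ_; _≤ᵇ_;
  _≤_; _<_; z≤n; s≤s; NonZero; >-nonZero; ≢-nonZero; ≢-nonZero⁻¹; nonTrivial⇒n>1)
open import Data.Nat.Properties
open import Data.Nat.DivMod using (m/n*n≡m; m*n/n≡m; m/n≤m; m≥n⇒m/n>0)
open import Data.Nat.Divisibility using (_∣_; _∣?_; divides; ∣⇒≤; *-cancelʳ-∣)
open import Data.Nat.GCD using (gcd; gcd[m,n]∣m; gcd[m,n]∣n; gcd[m,n]≢0)
open import Data.Nat.Coprimality using (coprime-divisor; coprime-/gcd)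
open import Data.Nat.Primality using (Prime; euclidsLemma; prime⇒irreducible; ¬prime[1]; prime⇒nonTrivial)
open import Data.Nat.ListAction using (sum)
open import Data.Nat.ListAction.Properties using (sum-++)
open import Data.List using ([]; _∷_; _++_; map; filter; upTo; length)
open import Data.List.Properties using (upTo-∷ʳ; map-++)
open import Data.List.Relation.Unary.All using (All; []; _∷_; zipWith)
open import Data.List.Relation.Unary.AllPairs using (_∷_)
open import Data.List.Relation.Unary.Unique.Propositional using (Unique)
import Data.List.Relation.Unary.Unique.Propositional.Properties as Unique
open import Data.List.Relation.Unary.All.Properties using (all-filter)
open import Data.Bool using (Bool; true; false; if_then_else_; _∧_)
open import Data.Bool.Properties using (∧-conicalˡ; ∧-conicalʳ)
open import Data.Product using (∃-syntax; _×_; _,_)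
open import Data.Sum using (inj₁; inj₂)
open import Function.Bundles using (_⇔_; mk⇔)
open import Relation.Nullary using (Dec; yes; no; does; ¬_; ¬?; contradiction)
open import Relation.Nullary.Decidable using (_×-dec_; _→-dec_; dec-true; dec-false; does-⇔)
open import Relation.Unary using (Decidable)
open import Relation.Binary.PropositionalEquality
open import Algebra.Properties.CommutativeSemigroup +-commutativeSemigroup using (interchange)

sumTo : ℕ → (ℕ → ℕ) → ℕ
sumTo zero    f = 0
sumTo (suc n) f = sumTo n f + f (suc n)

syntax sumTo n (λ d → e) = ∑[ d ≤ n ] e

∑-cong : ∀ n {f g : ℕ → ℕ} → (∀ {d} → 1 ≤ d → d ≤ n → f d ≡ g d) →
         ∑[ d ≤ n ] f d ≡ ∑[ d ≤ n ] g d
∑-cong zero    f≗g = refl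
∑-cong (suc n) f≗g = cong₂ _+_ (∑-cong n (λ 1≤d d≤n → f≗g 1≤d (m≤n⇒m≤1+n d≤n))) (f≗g (s≤s z≤n) ≤-refl)

∑-zero : ∀ n {f : ℕ → ℕ} → (∀ {d} → 1 ≤ d → d ≤ n → f d ≡ 0) → ∑[ d ≤ n ] f d ≡ 0
∑-zero zero    f≗0 = refl
∑-zero (suc n) f≗0 = cong₂ _+_ (∑-zero n (λ 1≤d d≤n → f≗0 1≤d (m≤n⇒m≤1+n d≤n))) (f≗0 (s≤s z≤n) ≤-refl)

∑-distrib-+ : ∀ n (f g : ℕ → ℕ) → ∑[ d ≤ n ] (f d + g d) ≡ ∑[ d ≤ n ] f d + ∑[ d ≤ n ] g d
∑-distrib-+ zero    f g = refl
∑-distrib-+ (suc n) f g = trans (cong (_+ (f (suc n) + g (suc n))) (∑-distrib-+ n f g))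
                                (interchange (∑[ d ≤ n ] f d) (∑[ d ≤ n ] g d) (f (suc n)) (g (suc n)))

∑-comm : ∀ m n (f : ℕ → ℕ → ℕ) → ∑[ i ≤ m ] ∑[ j ≤ n ] f i j ≡ ∑[ j ≤ n ] ∑[ i ≤ m ] f i j
∑-comm zero    n f = sym (∑-zero n (λ _ _ → refl))
∑-comm (suc m) n f = trans (cong (_+ ∑[ j ≤ n ] f (suc m) j) (∑-comm m n f))
                           (sym (∑-distrib-+ n (λ j → ∑[ i ≤ m ] f i j) (f (suc m))))

∑-truncate : ∀ {r} n (f : ℕ → ℕ) → r ≤ n → (∀ {d} → r < d → d ≤ n → f d ≡ 0) →
             ∑[ d ≤ n ] f d ≡ ∑[ d ≤ r ] f d
∑-truncate n f r≤n f≗0 with m≤n⇒m<n∨m≡n r≤n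
... | inj₂ refl = refl
∑-truncate (suc n) f r≤n f≗0 | inj₁ (s≤s r≤n′) =
  trans (cong₂ _+_ (∑-truncate n f r≤n′ (λ r<d d≤n → f≗0 r<d (m≤n⇒m≤1+n d≤n))) (f≗0 (s≤s r≤n′) ≤-refl))
        (+-identityʳ _)

when : ∀ {p} {P : Set p} → Dec P → ℕ → ℕ
when P? x = if does P? then x else 0

module _ {p} {P : Set p} where

  when-yes : ∀ {x} (P? : Dec P) → P → when P? x ≡ x
  when-yes {x} P? a = cong (if_then x else 0) (dec-true P? a)

  when-no : ∀ {x} (P? : Dec P) → ¬ P → when P? x ≡ 0
  when-no {x} P? ¬a = cong (if_then x else 0) (dec-false P? ¬a)

  when-≡0 : ∀ {x} (P? : Dec P) → (P → x ≡ 0) → when P? x ≡ 0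
  when-≡0 (yes a) x≡0 = x≡0 a
  when-≡0 (no _)  x≡0 = refl

  when-+ : ∀ {x y} (P? : Dec P) → when P? (x + y) ≡ when P? x + when P? y
  when-+ (yes _) = refl
  when-+ (no _)  = refl

  when-¬?+when : ∀ {x} (P? : Dec P) → when (¬? P?) x + when P? x ≡ x
  when-¬?+when (yes _) = refl
  when-¬?+when (no _)  = +-identityʳ _

  when-⇔ : ∀ {q} {Q : Set q} {x} → P ⇔ Q → (P? : Dec P) (Q? : Dec Q) → when P? x ≡ when Q? x
  when-⇔ {x = x} P⇔Q P? Q? = cong (if_then x else 0) (does-⇔ P⇔Q P? Q?)

∑-when-≡ : ∀ n {c} (g : ℕ → ℕ) → 1 ≤ c → c ≤ n → ∑[ d ≤ n ] when (d ≟ c) (g d) ≡ g c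
∑-when-≡ zero    g (s≤s _) ()
∑-when-≡ (suc n) {c} g 1≤c c≤1+n with m≤n⇒m<n∨m≡n c≤1+n
... | inj₁ (s≤s c≤n) = begin
  ∑[ d ≤ n ] when (d ≟ c) (g d) + when (suc n ≟ c) (g (suc n))
    ≡⟨ cong₂ _+_ (∑-when-≡ n g 1≤c c≤n) (when-no (suc n ≟ c) (>⇒≢ (s≤s c≤n))) ⟩
  g c + 0
    ≡⟨ +-identityʳ (g c) ⟩
  g c ∎
  where open ≡-Reasoning
... | inj₂ refl = cong₂ _+_ (∑-zero n (λ {d} _ d≤n → when-no (d ≟ suc n) (<⇒≢ (s≤s d≤n))))
                            (when-yes (suc n ≟ suc n) refl)

-- division with the junk value n ÷ 0 = 0, so that it needs no NonZero instance
_÷_ : ℕ → ℕ → ℕ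
n ÷ zero      = 0
n ÷ d@(suc _) = n / d

÷≡/ : ∀ m n .{{_ : NonZero n}} → m ÷ n ≡ m / n
÷≡/ m (suc n) = refl

∑-when-*≡ : ∀ {d n} (g : ℕ → ℕ) → 1 ≤ d → 1 ≤ n →
            ∑[ e ≤ n ] when (e * d ≟ n) (g e) ≡ when (d ∣? n) (g (n ÷ d))
∑-when-*≡ {d@(suc _)} {n} g _ 1≤n with d ∣? n
... | yes d∣n = begin
  ∑[ e ≤ n ] when (e * d ≟ n) (g e) ≡⟨ ∑-cong n (λ {e} _ _ → when-⇔ (e*d≡n⇔e≡n/d e) (e * d ≟ n) (e ≟ n / d)) ⟩
  ∑[ e ≤ n ] when (e ≟ n / d) (g e) ≡⟨ ∑-when-≡ n g (m≥n⇒m/n>0 (∣⇒≤ {{>-nonZero 1≤n}} d∣n)) (m/n≤m n d) ⟩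
  g (n / d)                         ≡⟨ sym (when-yes (d ∣? n) d∣n) ⟩
  when (d ∣? n) (g (n / d))         ∎
  where
  open ≡-Reasoning
  e*d≡n⇔e≡n/d : ∀ e → e * d ≡ n ⇔ e ≡ n / d
  e*d≡n⇔e≡n/d e = mk⇔ (λ e*d≡n → trans (sym (m*n/n≡m e d)) (cong (_/ d) e*d≡n))
                      (λ { refl → m/n*n≡m d∣n })
... | no ¬d∣n = trans (∑-zero n (λ {e} _ _ → when-no (e * d ≟ n) (λ e*d≡n → ¬d∣n (divides e (sym e*d≡n)))))
                      (sym (when-no (d ∣? n) ¬d∣n))

∑-divisors-flip : ∀ {n} (f : ℕ → ℕ) → 1 ≤ n →
                  ∑[ d ≤ n ] when (d ∣? n) (f d) ≡ ∑[ d ≤ n ] when (d ∣? n) (f (n ÷ d))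
∑-divisors-flip {n} f 1≤n = begin
  ∑[ d ≤ n ] when (d ∣? n) (f d)
    ≡⟨ ∑-cong n (λ {d} 1≤d _ → sym (∑-when-*≡ (λ _ → f d) 1≤d 1≤n)) ⟩
  ∑[ d ≤ n ] ∑[ e ≤ n ] when (e * d ≟ n) (f d)
    ≡⟨ ∑-comm n n (λ d e → when (e * d ≟ n) (f d)) ⟩
  ∑[ e ≤ n ] ∑[ d ≤ n ] when (e * d ≟ n) (f d)
    ≡⟨ ∑-cong n (λ {e} 1≤e _ → trans (∑-cong n (λ {d} _ _ → when-⇔ (swap e d) (e * d ≟ n) (d * e ≟ n)))
                                     (∑-when-*≡ f 1≤e 1≤n)) ⟩
  ∑[ e ≤ n ] when (e ∣? n) (f (n ÷ e)) ∎
  where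
  open ≡-Reasoning
  swap : ∀ e d → e * d ≡ n ⇔ d * e ≡ n
  swap e d = mk⇔ (trans (*-comm d e)) (trans (*-comm e d))

sum-filter : ∀ {p} {P : ℕ → Set p} (P? : Decidable P) xs →
             sum (filter P? xs) ≡ sum (map (λ x → when (P? x) x) xs)
sum-filter P? []       = refl
sum-filter P? (x ∷ xs) with does (P? x)
... | true  = cong (x +_) (sum-filter P? xs)
... | false = sum-filter P? xs

sum-map-range1 : ∀ n (g : ℕ → ℕ) → sum (map g (range1 n)) ≡ ∑[ d ≤ n ] g d
sum-map-range1 zero    g = refl
sum-map-range1 (suc n) g = begin
  sum (map g (map suc (upTo (suc n))))
    ≡⟨ cong (λ xs → sum (map g (map suc xs))) (sym (upTo-∷ʳ n)) ⟩
  sum (map g (map suc (upTo n ++ n ∷ [])))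
    ≡⟨ cong (λ xs → sum (map g xs)) (map-++ suc (upTo n) (n ∷ [])) ⟩
  sum (map g (range1 n ++ suc n ∷ []))
    ≡⟨ cong sum (map-++ g (range1 n) (suc n ∷ [])) ⟩
  sum (map g (range1 n) ++ g (suc n) ∷ [])
    ≡⟨ sum-++ (map g (range1 n)) (g (suc n) ∷ []) ⟩
  sum (map g (range1 n)) + (g (suc n) + 0)
    ≡⟨ cong₂ _+_ (sum-map-range1 n g) (+-identityʳ (g (suc n))) ⟩
  ∑[ d ≤ n ] g d + g (suc n) ∎
  where open ≡-Reasoning

σ≡∑ : ∀ n → σ n ≡ ∑[ d ≤ n ] when (d ∣? n) d
σ≡∑ n = trans (sum-filter (_∣? n) (range1 n)) (sum-map-range1 n (λ d → when (d ∣? n) d))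

σ-pairs : ℕ → ℕ → ℕ
σ-pairs r n = ∑[ d ≤ r ] when (d ∣? n) (d + when (r <? n ÷ d) (n ÷ d))

cofactor≤ : ∀ {d n r} → d ∣ n → r < d → n < suc r * suc r → n ÷ d ≤ r
cofactor≤ {d@(suc _)} {n} {r} d∣n r<d n<[1+r]² = ≮⇒≥ λ r<n/d → <⇒≱ n<[1+r]² (begin
  suc r * suc r ≤⟨ *-mono-≤ r<n/d r<d ⟩
  n / d * d     ≡⟨ m/n*n≡m d∣n ⟩
  n             ∎)
  where open ≤-Reasoning

-- a divisor d > r of n has cofactor n/d ≤ r, so the divisors above r are the cofactors above r
σ≡σ-pairs : ∀ {n r} → 1 ≤ n → r ≤ n → n < suc r * suc r → σ n ≡ σ-pairs r n
σ≡σ-pairs {n} {r} 1≤n r≤n n<[1+r]² = begin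
  σ n
    ≡⟨ σ≡∑ n ⟩
  ∑[ d ≤ n ] when (d ∣? n) d
    ≡⟨ ∑-cong n (λ {d} _ _ → split d) ⟩
  ∑[ d ≤ n ] (small d + large d)
    ≡⟨ ∑-distrib-+ n small large ⟩
  ∑[ d ≤ n ] small d + ∑[ d ≤ n ] large d
    ≡⟨ cong (∑[ d ≤ n ] small d +_) (∑-divisors-flip (λ d → when (r <? d) d) 1≤n) ⟩
  ∑[ d ≤ n ] small d + ∑[ d ≤ n ] largeCofactor d
    ≡⟨ sym (∑-distrib-+ n small largeCofactor) ⟩
  ∑[ d ≤ n ] (small d + largeCofactor d)
    ≡⟨ ∑-truncate n (λ d → small d + largeCofactor d) r≤n (λ r<d _ → cong₂ _+_ (small≡0 r<d) (largeCofactor≡0 r<d)) ⟩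
  ∑[ d ≤ r ] (small d + largeCofactor d)
    ≡⟨ ∑-cong r (λ _ d≤r → merge d≤r) ⟩
  σ-pairs r n ∎
  where
  open ≡-Reasoning
  small large largeCofactor : ℕ → ℕ
  small d = when (d ∣? n) (when (¬? (r <? d)) d)
  large d = when (d ∣? n) (when (r <? d) d)
  largeCofactor d = when (d ∣? n) (when (r <? n ÷ d) (n ÷ d))

  split : ∀ d → when (d ∣? n) d ≡ small d + large d
  split d = trans (cong (when (d ∣? n)) (sym (when-¬?+when (r <? d)))) (when-+ (d ∣? n))

  small≡0 : ∀ {d} → r < d → small d ≡ 0
  small≡0 {d} r<d = when-≡0 (d ∣? n) (λ _ → when-no (¬? (r <? d)) (λ r≮d → r≮d r<d))

  largeCofactor≡0 : ∀ {d} → r < d → largeCofactor d ≡ 0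
  largeCofactor≡0 {d} r<d =
    when-≡0 (d ∣? n) (λ d∣n → when-no (r <? n ÷ d) (≤⇒≯ (cofactor≤ d∣n r<d n<[1+r]²)))

  merge : ∀ {d} → d ≤ r → small d + largeCofactor d ≡ when (d ∣? n) (d + when (r <? n ÷ d) (n ÷ d))
  merge {d} d≤r =
    trans (cong (λ x → when (d ∣? n) x + largeCofactor d) (when-yes (¬? (r <? d)) (≤⇒≯ d≤r)))
          (sym (when-+ (d ∣? n)))

reducedNumerator : ℕ → ℕ → ℕ
reducedNumerator s n = s ÷ gcd s n

abundancyNumerator : ℕ → ℕ
abundancyNumerator n = reducedNumerator (σ n) n

reducedNumerator∣ : ∀ {s n a} .{{_ : NonZero n}} → s ∣ a * n → reducedNumerator s n ∣ a
reducedNumerator∣ {s} {n} {a} s∣a*n =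
  subst (_∣ a) (sym (÷≡/ s g)) (coprime-divisor (coprime-/gcd s n) s/g∣n/g*a)
  where
  g : ℕ
  g = gcd s n
  instance
    g≢0 : NonZero g
    g≢0 = ≢-nonZero (gcd[m,n]≢0 s n (inj₂ (≢-nonZero⁻¹ n)))
  a*n≡ : a * n ≡ n / g * a * g
  a*n≡ = begin
    a * n           ≡⟨ cong (a *_) (sym (m/n*n≡m (gcd[m,n]∣n s n))) ⟩
    a * (n / g * g) ≡⟨ sym (*-assoc a (n / g) g) ⟩
    a * (n / g) * g ≡⟨ cong (_* g) (*-comm a (n / g)) ⟩
    n / g * a * g   ∎
    where open ≡-Reasoning
  s/g∣n/g*a : s / g ∣ n / g * a
  s/g∣n/g*a = *-cancelʳ-∣ g (subst₂ _∣_ (sym (m/n*n≡m (gcd[m,n]∣m s n))) a*n≡ s∣a*n)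

∣m*p⇒∣m : ∀ {q p m} → Prime q → Prime p → q ≢ p → q ∣ m * p → q ∣ m
∣m*p⇒∣m {q} {p} {m} q-prime p-prime q≢p q∣m*p with euclidsLemma m p q-prime q∣m*p
... | inj₁ q∣m = q∣m
... | inj₂ q∣p with prime⇒irreducible p-prime q∣p
...   | inj₁ refl = contradiction q-prime ¬prime[1]
...   | inj₂ q≡p  = contradiction q≡p q≢p

2^length≤ : ∀ {n} ps → Unique ps → All (λ p → Prime p × p ∣ n) ps → 1 ≤ n → 2 ^ length ps ≤ n
2^length≤ [] _ _ 1≤n = 1≤n
2^length≤ (p ∷ ps) (p∉ps ∷ ps-unique) ((p-prime , divides zero refl) ∷ _) ()
2^length≤ (p ∷ ps) (p∉ps ∷ ps-unique) ((p-prime , divides m@(suc _) refl) ∷ ps-divide) _ = begin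
  2 * 2 ^ length ps ≤⟨ *-mono-≤ (nonTrivial⇒n>1 p {{prime⇒nonTrivial p-prime}}) 2^length-ps≤m ⟩
  p * m             ≡⟨ *-comm p m ⟩
  m * p             ∎
  where
  open ≤-Reasoning
  divides-m : ∀ {q} → p ≢ q × Prime q × q ∣ m * p → Prime q × q ∣ m
  divides-m (p≢q , q-prime , q∣m*p) = q-prime , ∣m*p⇒∣m q-prime p-prime (≢-sym p≢q) q∣m*p
  2^length-ps≤m : 2 ^ length ps ≤ m
  2^length-ps≤m = 2^length≤ ps ps-unique (zipWith divides-m (p∉ps , ps-divide)) (s≤s z≤n)

2^ω≤ : ∀ {n} → 1 ≤ n → 2 ^ ω n ≤ n
2^ω≤ {n} = bound _
  where
  bound : (P? : Decidable (λ p → Prime p × p ∣ n)) → 1 ≤ n → 2 ^ length (filter P? (range1 n)) ≤ n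
  bound P? = 2^length≤ _ (Unique.filter⁺ P? (Unique.map⁺ suc-injective (Unique.upTo⁺ n)))
                         (all-filter P? (range1 n))

-- σ-pairs with `d ∣? n` and `r <? m` replaced by the Boolean tests they unfold to, which evaluate faster
σ-pairsᵇ : ℕ → ℕ → ℕ
σ-pairsᵇ r n = ∑[ d ≤ r ] term d
  where
  term : ℕ → ℕ
  term zero      = 0
  term d@(suc _) = if n % d ≡ᵇ 0 then d + (if r <ᵇ n / d then n / d else 0) else 0

σ-pairs≡σ-pairsᵇ : ∀ r n → σ-pairs r n ≡ σ-pairsᵇ r n
σ-pairs≡σ-pairsᵇ r n = ∑-cong r λ { {suc d} _ _ → refl }

-- capping the exponent at 17 keeps 2^k small to evaluate and loses nothing, as 10⁵ < 2^17
OddCertificate : ℕ → ℕ → Set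
OddCertificate r n = ¬ 2 ∣ n → r ≤ n × n < suc r * suc r × n < 2 ^ (reducedNumerator (σ-pairsᵇ r n) n ⊓ 17)

oddCertificate? : ∀ r n → Dec (OddCertificate r n)
oddCertificate? r n = ¬? (2 ∣? n) →-dec
  (r ≤? n ×-dec n <? suc r * suc r ×-dec n <? 2 ^ (reducedNumerator (σ-pairsᵇ r n) n ⊓ 17))

-- a running guess for ⌊√n⌋; it needs no proof, as OddCertificate re-checks it
nextRoot : ℕ → ℕ → ℕ
nextRoot r n = if suc r * suc r ≤ᵇ suc n then suc r else r

certifyFrom : ℕ → ℕ → ℕ → Bool
certifyFrom zero    r n = true
certifyFrom (suc k) r n = does (oddCertificate? r n) ∧ certifyFrom k (nextRoot r n) (suc n)

does≡true⇒ : ∀ {p} {P : Set p} (P? : Dec P) → does P? ≡ true → P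
does≡true⇒ (yes a) _ = a

certifyFrom-sound : ∀ k r n → certifyFrom k r n ≡ true → ∀ {i} → i < k → ∃[ r′ ] OddCertificate r′ (n + i)
certifyFrom-sound (suc k) r n ok {zero} _ rewrite +-identityʳ n =
  r , does≡true⇒ (oddCertificate? r n) (∧-conicalˡ (does (oddCertificate? r n)) _ ok)
certifyFrom-sound (suc k) r n ok {suc i} (s≤s i<k) rewrite +-suc n i =
  certifyFrom-sound k (nextRoot r n) (suc n) (∧-conicalʳ (does (oddCertificate? r n)) _ ok) i<k

certificate-below-10⁵ : ∀ {n} → n < 100000 → ∃[ r ] OddCertificate r n
certificate-below-10⁵ = certifyFrom-sound 100000 0 0 refl

odd⇒n<2^abundancyNumerator : ∀ {n} → 1 ≤ n → n < 100000 → ¬ 2 ∣ n →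
                              n < 2 ^ (abundancyNumerator n ⊓ 17)
odd⇒n<2^abundancyNumerator {n} 1≤n n<10⁵ n-odd with certificate-below-10⁵ n<10⁵
... | r , certificate with certificate n-odd
...   | r≤n , n<[1+r]² , n<2^k =
  subst (λ s → n < 2 ^ (reducedNumerator s n ⊓ 17))
        (sym (trans (σ≡σ-pairs 1≤n r≤n n<[1+r]²) (σ-pairs≡σ-pairsᵇ r n))) n<2^k

theorem4p1 : (n : ℕ) → 1 ≤ n → n < 100000 → ¬ (2 ∣ n) → ¬ StrongAlpha11 n
theorem4p1 n 1≤n n<10⁵ n-odd (α₁ , α₂ , 1≤α₁ , _ , _ , α₂σ≡α₁n , _ , α₁⊔α₂≤ω) =
  <⇒≱ (odd⇒n<2^abundancyNumerator 1≤n n<10⁵ n-odd) (begin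
    2 ^ (k ⊓ 17) ≤⟨ ^-monoʳ-≤ 2 (m⊓n≤m k 17) ⟩
    2 ^ k        ≤⟨ ^-monoʳ-≤ 2 k≤α₁ ⟩
    2 ^ α₁       ≤⟨ ^-monoʳ-≤ 2 (≤-trans (m≤m⊔n α₁ α₂) α₁⊔α₂≤ω) ⟩
    2 ^ ω n      ≤⟨ 2^ω≤ 1≤n ⟩
    n            ∎)
  where
  open ≤-Reasoning
  k : ℕ
  k = abundancyNumerator n
  k≤α₁ : k ≤ α₁
  k≤α₁ = ∣⇒≤ {{>-nonZero 1≤α₁}} (reducedNumerator∣ {{>-nonZero 1≤n}} (divides α₂ (sym α₂σ≡α₁n)))
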